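{- Let $\alpha>1$ be a constant and consider the modified top tree construction algorithm described in the context, run on a tree $T$. Suppose that at the beginning of the $t^\text{th}$ iteration there are $m=p+q$ clusters (edges of $\widetilde T$), where $q$ is the number of these clusters of size larger than $\alpha^t$. Then after the $t^\text{th}$ iteration there are at most $\frac78 m+q$ clusters.
   Context: Trees are rooted and ordered, with node labels from an alphabet $\Sigma$. For a node $v$ with children $v_1,\dots,v_k$, $T(v)$ is the subtree rooted at $v$, $F(v)=T(v_1)\cup\dots\cup T(v_k)$, and $T(v,v_s,v_r)=\{v\}\cup T(v_s)\cup\dots\cup T(v_r)$. A cluster is either $T(v,v_s,v_r)$ (top boundary node $v$) or $T(v,v_s,v_r)\setminus F(u)$ for $u\in T(v,v_s,v_r)\setminus\{v\}$ (top boundary $v$, bottom boundary $u$). Two edge-disjoint clusters sharing exactly one boundary node whose union is a cluster can be merged into the union. The size of a cluster is the number of edges of $T$ it contains. The original algorithm (Bille et al.) maintains an ordered tree $\widetilde T$, initially $T$, whose edges correspond to the current clusters; merging two edges of $\widetilde T$ merges the corresponding clusters and replaces them by one edge (a vertical merge of $(v_1,v_2),(v_2,v_3)$ removes $v_2$ and creates edge $(v_1,v_3)$; a horizontal merge of two sibling edges below $v$, one of which goes to a leaf, removes that leaf). One iteration of the original algorithm consists of: (1) Horizontal merges: for each node $v$ of $\widetilde T$ with $k\ge2$ children $v_1,\dots,v_k$, for $i=1,\dots,\lfloor k/2\rfloor$ merge $(v,v_{2i-1})$ and $(v,v_{2i})$ if $v_{2i-1}$ or $v_{2i}$ is a leaf;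 if $k$ is odd, $v_k$ is a leaf and $v_{k-2},v_{k-1}$ are non-leaves, also merge $(v,v_{k-1})$ and $(v,v_k)$. (2) Vertical merges: for each maximal path $v_1,\dots,v_p$ with $v_{i+1}$ the parent of $v_i$ and $v_2,\dots,v_{p-1}$ having a single child: if $p$ is even merge consecutive pairs $\{(v_1,v_2),(v_2,v_3)\},\{(v_3,v_4),(v_4,v_5)\},\dots$ up to the edge $(v_{p-2},v_{p-1})$; if $p$ is odd merge consecutive pairs up to the edge $(v_{p-3},v_{p-2})$, and if $(v_{p-1},v_p)$ was not merged in step (1) also merge $\{(v_{p-2},v_{p-1}),(v_{p-1},v_p)\}$. The modified algorithm with parameter $\alpha>1$: for $t=1,2,\dots$ (until a single cluster remains), in the $t^\text{th}$ iteration it computes all merges that one iteration of the original algorithm (both steps) would perform on the current $\widetilde T$, and then applies only those merges in which both participating clusters have size at most $\alpha^t$. -}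

module Defs where

open import Data.Nat using (ℕ; zero; suc; _+_; _≤ᵇ_; _<?_)
open import Data.Bool using (Bool; true; false; if_then_else_; _∧_; _∨_; not)
open import Data.List using (List; []; _∷_; _++_; length; filter)
open import Data.List.NonEmpty using (List⁺; _∷_; _∷⁺_; reverse)
open import Data.Product using (_×_; _,_; proj₂)

data LTree (Lbl : Set) : Set where
  node : Lbl → List (LTree Lbl) → LTree Lbl

-- Ordered rooted trees whose edges carry a label of type L.
-- The current tree T̃ is a  Tr ℕ : each edge carries the size (number of
-- edges of T) of the cluster it represents.

data Tr (L : Set) : Set where
  node : List (L × Tr L) → Tr L

isLeaf : {L : Set} → Tr L → Bool
isLeaf (node []) = true
isLeaf (node (_ ∷ _)) = false

mutual
  labels : {L : Set} → Tr L → List L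
  labels (node cs) = labelsL cs

  labelsL : {L : Set} → List (L × Tr L) → List L
  labelsL [] = []
  labelsL ((l , s) ∷ cs) = l ∷ labels s ++ labelsL cs

clusters : Tr ℕ → ℕ
clusters T = length (labels T)

bigClusters : ℕ → Tr ℕ → ℕ
bigClusters b T = length (filter (b <?_) (labels T))

mutual
  initial : {Lbl : Set} → LTree Lbl → Tr ℕ
  initial (node _ ts) = node (initialL ts)

  initialL : {Lbl : Set} → List (LTree Lbl) → List (ℕ × Tr ℕ)
  initialL [] = []
  initialL (t ∷ ts) = (1 , initial t) ∷ initialL ts

-- Merges computed by one iteration of the original algorithm are recorded
-- as expressions over the clusters present at the start of the iteration.

data Cl : Set where
  base : ℕ → Cl
  -- horizontal merge of sibling edges (v,v_{2i-1}) , (v,v_{2i}) (in this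
  -- order); the Bool is true iff the first child is the removed leaf
  -- (the new edge then leads to the second child), false iff the second
  -- child is the removed leaf (the new edge leads to the first child)
  hm   : Bool → Cl → Cl → Cl
  -- vertical merge: upper edge (v2,v3) and lower edge (v1,v2)
  vm   : Cl → Cl → Cl

size : Cl → ℕ
size (base s) = s
size (hm _ x y) = size x + size y
size (vm x y) = size x + size y

isHm : Cl → Bool
isHm (hm _ _ _) = true
isHm (base _) = false
isHm (vm _ _) = false

toCl : Tr ℕ → Tr Cl
toCl (node cs) = node (go cs)
  where
  go : List (ℕ × Tr ℕ) → List (Cl × Tr Cl)
  go [] = []
  go ((s , t) ∷ cs) = (base s , toCl t) ∷ go cs

hmergeE : Cl × Tr Cl → Cl × Tr Cl → Cl × Tr Cl
hmergeE (c₁ , s₁) (c₂ , s₂) =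
  if isLeaf s₁ then (hm true c₁ c₂ , s₂) else (hm false c₁ c₂ , s₁)

pairStep : Cl × Tr Cl → Cl × Tr Cl → List (Cl × Tr Cl)
pairStep x y =
  if isLeaf (proj₂ x) ∨ isLeaf (proj₂ y) then hmergeE x y ∷ [] else x ∷ y ∷ []

hpairs : List (Cl × Tr Cl) → List (Cl × Tr Cl)
hpairs [] = []
hpairs (x ∷ []) = x ∷ []
hpairs (x ∷ y ∷ []) = pairStep x y
hpairs (x ∷ y ∷ z ∷ []) =
  if not (isLeaf (proj₂ x)) ∧ not (isLeaf (proj₂ y)) ∧ isLeaf (proj₂ z)
  then x ∷ hmergeE y z ∷ []
  else pairStep x y ++ z ∷ []
hpairs (x ∷ y ∷ zs@(z ∷ w ∷ rest)) = pairStep x y ++ hpairs zs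

mutual
  step1 : Tr Cl → Tr Cl
  step1 (node cs) = node (hpairs (step1L cs))

  step1L : List (Cl × Tr Cl) → List (Cl × Tr Cl)
  step1L [] = []
  step1L ((c , s) ∷ cs) = (c , step1 s) ∷ step1L cs

-- Step (2): vertical merges along maximal paths.
-- vp e₁ [e₂,…,e_{p-1}] pairs the edges of a maximal path listed bottom-up
-- (e_i = (v_i , v_{i+1})).

vp : Cl → List Cl → List⁺ Cl
vp a [] = a ∷ []
vp a (b ∷ []) = if not (isHm b) then vm b a ∷ [] else a ∷ (b ∷ [])
vp a (b ∷ c ∷ rest) = vm b a ∷⁺ vp c rest

-- rebuild a path from its edges listed top-down, ending in subtree b
buildPath : List⁺ Cl → Tr Cl → Cl × Tr Cl
buildPath (d ∷ ds) b = go d ds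
  where
  go : Cl → List Cl → Cl × Tr Cl
  go d [] = (d , b)
  go d (d' ∷ ds) = (d , node (go d' ds ∷ []))

mutual
  step2 : Tr Cl → Tr Cl
  step2 (node cs) = node (startAll cs)

  -- every child edge of the root or of a node with ≥ 2 children is the top
  -- edge of a maximal path
  startAll : List (Cl × Tr Cl) → List (Cl × Tr Cl)
  startAll [] = []
  startAll ((c , s) ∷ cs) = walk c [] s ∷ startAll cs

  -- walk low above s : low is the lowest edge of the path found so far,
  -- above the edges above it (bottom-up), s the subtree below low
  walk : Cl → List Cl → Tr Cl → Cl × Tr Cl
  walk low above (node ((c , s) ∷ [])) = walk c (low ∷ above) s
  walk low above (node cs) = buildPath (reverse (vp low above)) (node (startAll cs))

-- Applying only the merges whose two participating clusters both have
-- size at most the threshold b; the other merges are not performed.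

leafTr : Tr ℕ
leafTr = node []

okMerge : ℕ → Cl → Cl → Bool
okMerge b x y = (size x ≤ᵇ b) ∧ (size y ≤ᵇ b)

-- realise c sub : the edges (below a fixed top node) that the expression c
-- becomes, where sub is the (realised) subtree at its lower end
realise : ℕ → Cl → Tr ℕ → List (ℕ × Tr ℕ)
realise b (base s) sub = (s , sub) ∷ []
realise b (hm f x y) sub =
  if okMerge b x y then (size x + size y , sub) ∷ []
  else (if f then realise b x leafTr ++ realise b y sub
             else realise b x sub ++ realise b y leafTr)
realise b (vm x y) sub =
  if okMerge b x y then (size x + size y , sub) ∷ []
  else realise b x (node (realise b y sub))

mutual
  realiseTr : ℕ → Tr Cl → Tr ℕ
  realiseTr b (node cs) = node (realiseL b cs)

  realiseL : ℕ → List (Cl × Tr Cl) → List (ℕ × Tr ℕ)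
  realiseL b [] = []
  realiseL b ((c , s) ∷ cs) = realise b c (realiseTr b s) ++ realiseL b cs

-- one iteration of the modified algorithm with size bound b (= α^t)
iteration : ℕ → Tr ℕ → Tr ℕ
iteration b T = realiseTr b (step2 (step1 (toCl T)))

run : {Lbl : Set} → (ℕ → ℕ) → LTree Lbl → ℕ → Tr ℕ
run θ T zero = initial T
run θ T (suc k) = iteration (θ (suc k)) (run θ T k)

{-# OPTIONS --safe #-}
-- Give every merge expression c of an iteration with threshold b the potential
--   φ c = 8 · (clusters c finally becomes) − 7 · (old clusters in c) − 8 · (old clusters in c larger than b).
-- Its sum over T̃ is 8 · (clusters after) − 7m − 8q, so it suffices that this sum is ≤ 0.
-- An old cluster left alone costs at most +1, a large one −7, and every merge of step (1) or (2),
-- whether carried out (it absorbs two old clusters) or blocked (one side is large), at most −5.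
-- Hence a maximal path of step (2) with at least two edges contributes at most −4, and by the pairing
-- of step (1) the paths leaving a node with at least two children contribute at most −2 in total;
-- this bound propagates from the leaves to the root.
module Submission where

open import Defs
open import Data.Nat using (ℕ; suc; _+_; _*_; _≤_; z≤n; s≤s; _≤ᵇ_; _<ᵇ_; _<?_)
import Data.Nat.Properties as ℕ
import Data.Nat.Tactic.RingSolver as ℕ-Ring
open import Data.Integer as ℤ using (ℤ; +_; 0ℤ)
import Data.Integer.Properties as ℤ
import Data.Integer.Tactic.RingSolver as ℤ-Ring
open import Data.Integer.Literals using (negative)
open import Agda.Builtin.FromNeg using (Negative)
open import Data.Bool using (true; false; not; _∧_; _∨_; if_then_else_)
open import Data.List using (List; []; _∷_; _++_; length; map; foldr; filter)
import Data.List as List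
import Data.List.Properties as List
open import Data.List.NonEmpty as List⁺ using (List⁺; _∷_; _∷⁺_; toList)
open import Data.List.Relation.Unary.All using (All; []; _∷_)
import Data.List.Relation.Unary.All.Properties as All
import Data.Vec as Vec
import Data.Vec.Properties as Vec
open import Data.Product using (_×_; _,_; proj₂)
open import Function using (_∘_)
open import Relation.Binary.PropositionalEquality
open import Relation.Nullary.Decidable using (True; toWitness)
open import Relation.Nullary.Negation using (contradiction)
open import Data.List.Relation.Binary.Permutation.Setoid.Properties (setoid ℤ)
  using (↭-reverse; foldr-commMonoid)

-- tt must be in scope: it is the instance discharging the constraints of negative integer literals.
open import Data.Unit using (tt)

instance
  ℤ-negative : Negative ℤ
  ℤ-negative = negative

toList-reverse : ∀ {A : Set} (xs : List⁺ A) → toList (List⁺.reverse xs) ≡ List.reverse (toList xs)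
toList-reverse {A} (x ∷ xs) = begin
  toList (List⁺.fromVec (Vec.reverse v))  ≡⟨ toList-fromVec (Vec.reverse v) ⟩
  Vec.toList (Vec.reverse v)               ≡⟨ Vec.toList-reverse v ⟩
  List.reverse (Vec.toList v)              ≡⟨ cong (List.reverse ∘ (x ∷_)) (Vec.toList∘fromList xs) ⟩
  List.reverse (x ∷ xs)                    ∎
  where
  open ≡-Reasoning
  v : Vec.Vec A (suc (List.length xs))
  v = x Vec.∷ Vec.fromList xs
  toList-fromVec : ∀ {n} (u : Vec.Vec A (suc n)) → toList (List⁺.fromVec u) ≡ Vec.toList u
  toList-fromVec (y Vec.∷ ys) = refl

sumℤ : List ℤ → ℤ
sumℤ = foldr ℤ._+_ 0ℤ

sumℤ-++ : ∀ xs ys → sumℤ (xs ++ ys) ≡ sumℤ xs ℤ.+ sumℤ ys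
sumℤ-++ []       ys = sym (ℤ.+-identityˡ (sumℤ ys))
sumℤ-++ (x ∷ xs) ys = trans (cong (ℤ._+_ x) (sumℤ-++ xs ys)) (sym (ℤ.+-assoc x (sumℤ xs) (sumℤ ys)))

sumℤ-reverse : ∀ xs → sumℤ (List.reverse xs) ≡ sumℤ xs
sumℤ-reverse xs = foldr-commMonoid ℤ.+-0-isCommutativeMonoid (↭-reverse xs)

[a-b]+[c-d]≡[a+c]-[b+d] : ∀ a b c d → (a ℤ.- b) ℤ.+ (c ℤ.- d) ≡ (a ℤ.+ c) ℤ.- (b ℤ.+ d)
[a-b]+[c-d]≡[a+c]-[b+d] = ℤ-Ring.solve-∀

≤-lit : ∀ {i j} {_ : True (i ℤ.≤? j)} → i ℤ.≤ j
≤-lit {_} {_} {i≤j} = toWitness i≤j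

loosen : ∀ {x i j} → x ℤ.≤ i → {_ : True (i ℤ.≤? j)} → x ℤ.≤ j
loosen x≤i {i≤j} = ℤ.≤-trans x≤i (toWitness i≤j)

≡-≤-trans : ∀ {x y z} → x ≡ y → y ℤ.≤ z → x ℤ.≤ z
≡-≤-trans refl y≤z = y≤z

infixr 6 _⊕_
_⊕_ : ∀ {x y i j} → x ℤ.≤ i → y ℤ.≤ j → x ℤ.+ y ℤ.≤ i ℤ.+ j
_⊕_ = ℤ.+-mono-≤

m+k≤n⇒+m-+n≤-k : ∀ {m n} k → m + k ≤ n → + m ℤ.- + n ℤ.≤ ℤ.- + k
m+k≤n⇒+m-+n≤-k {m} {n} k m+k≤n = begin
  + m ℤ.- + n            ≤⟨ ℤ.+-monoʳ-≤ (+ m) (ℤ.neg-mono-≤ (ℤ.+≤+ m+k≤n)) ⟩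
  + m ℤ.- + (m + k)      ≡⟨ cong (λ p → + m ℤ.- p) (ℤ.pos-+ m k) ⟩
  + m ℤ.- (+ m ℤ.+ + k)  ≡⟨ cancel (+ m) (+ k) ⟩
  ℤ.- + k                ∎
  where
  open ℤ.≤-Reasoning
  cancel : ∀ a c → a ℤ.- (a ℤ.+ c) ≡ ℤ.- c
  cancel = ℤ-Ring.solve-∀

mutual
  ΣT : (Cl → ℤ) → Tr Cl → ℤ
  ΣT w (node es) = ΣL w es

  ΣL : (Cl → ℤ) → List (Cl × Tr Cl) → ℤ
  ΣL w []       = 0ℤ
  ΣL w (e ∷ es) = ΣE w e ℤ.+ ΣL w es

  ΣE : (Cl → ℤ) → Cl × Tr Cl → ℤ
  ΣE w (c , s) = w c ℤ.+ ΣT w s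

Σ⁺ : (Cl → ℤ) → List⁺ Cl → ℤ
Σ⁺ w ds = sumℤ (map w (toList ds))

ΣL-++ : ∀ w xs ys → ΣL w (xs ++ ys) ≡ ΣL w xs ℤ.+ ΣL w ys
ΣL-++ w []       ys = sym (ℤ.+-identityˡ (ΣL w ys))
ΣL-++ w (x ∷ xs) ys =
  trans (cong (ℤ._+_ (ΣE w x)) (ΣL-++ w xs ys)) (sym (ℤ.+-assoc (ΣE w x) (ΣL w xs) (ΣL w ys)))

mutual
  ΣT-sub : ∀ f g t → ΣT (λ c → f c ℤ.- g c) t ≡ ΣT f t ℤ.- ΣT g t
  ΣT-sub f g (node es) = ΣL-sub f g es

  ΣL-sub : ∀ f g es → ΣL (λ c → f c ℤ.- g c) es ≡ ΣL f es ℤ.- ΣL g es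
  ΣL-sub f g []             = refl
  ΣL-sub f g ((c , s) ∷ es) = begin
    ((f c ℤ.- g c) ℤ.+ ΣT (λ c → f c ℤ.- g c) s) ℤ.+ ΣL (λ c → f c ℤ.- g c) es
      ≡⟨ cong₂ (λ p q → ((f c ℤ.- g c) ℤ.+ p) ℤ.+ q) (ΣT-sub f g s) (ΣL-sub f g es) ⟩
    ((f c ℤ.- g c) ℤ.+ (ΣT f s ℤ.- ΣT g s)) ℤ.+ (ΣL f es ℤ.- ΣL g es)
      ≡⟨ cong (ℤ._+ (ΣL f es ℤ.- ΣL g es)) ([a-b]+[c-d]≡[a+c]-[b+d] (f c) (g c) (ΣT f s) (ΣT g s)) ⟩
    ((f c ℤ.+ ΣT f s) ℤ.- (g c ℤ.+ ΣT g s)) ℤ.+ (ΣL f es ℤ.- ΣL g es)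
      ≡⟨ [a-b]+[c-d]≡[a+c]-[b+d] (f c ℤ.+ ΣT f s) (g c ℤ.+ ΣT g s) (ΣL f es) (ΣL g es) ⟩
    ΣL f ((c , s) ∷ es) ℤ.- ΣL g ((c , s) ∷ es) ∎
    where open ≡-Reasoning

Σ⁺-∷⁺ : ∀ w x ds → Σ⁺ w (x ∷⁺ ds) ≡ w x ℤ.+ Σ⁺ w ds
Σ⁺-∷⁺ w x (d ∷ ds) = refl

Σ⁺-reverse : ∀ w ds → Σ⁺ w (List⁺.reverse ds) ≡ Σ⁺ w ds
Σ⁺-reverse w ds = begin
  sumℤ (map w (toList (List⁺.reverse ds)))  ≡⟨ cong (sumℤ ∘ map w) (toList-reverse ds) ⟩
  sumℤ (map w (List.reverse (toList ds)))   ≡⟨ cong sumℤ (List.reverse-map w (toList ds)) ⟩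
  sumℤ (List.reverse (map w (toList ds)))   ≡⟨ sumℤ-reverse (map w (toList ds)) ⟩
  sumℤ (map w (toList ds))                  ∎
  where open ≡-Reasoning

ΣE-buildPath : ∀ w ds s → ΣE w (buildPath ds s) ≡ Σ⁺ w ds ℤ.+ ΣT w s
ΣE-buildPath w (d ∷ ds) s = path d ds
  where
  regroup : ∀ a p t → a ℤ.+ ((p ℤ.+ t) ℤ.+ 0ℤ) ≡ (a ℤ.+ p) ℤ.+ t
  regroup = ℤ-Ring.solve-∀

  path : ∀ d ds → ΣE w (buildPath (d ∷ ds) s) ≡ Σ⁺ w (d ∷ ds) ℤ.+ ΣT w s
  path d []        = cong (ℤ._+ ΣT w s) (sym (ℤ.+-identityʳ (w d)))
  path d (d′ ∷ ds) = trans (cong (λ p → w d ℤ.+ (p ℤ.+ 0ℤ)) (path d′ ds))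
                           (regroup (w d) (Σ⁺ w (d′ ∷ ds)) (ΣT w s))

ΣE-buildPath-reverse : ∀ w ds s → ΣE w (buildPath (List⁺.reverse ds) s) ≡ Σ⁺ w ds ℤ.+ ΣT w s
ΣE-buildPath-reverse w ds s =
  trans (ΣE-buildPath w (List⁺.reverse ds) s) (cong (ℤ._+ ΣT w s) (Σ⁺-reverse w ds))

-- Steps (1) and (2)

All-pairStep : ∀ {P Q : Cl × Tr Cl → Set} →
               (∀ {e} → P e → Q e) → (∀ {x y} → P x → P y → Q (hmergeE x y)) →
               ∀ {x y} → P x → P y → All Q (pairStep x y)
All-pairStep keep merge {x} {y} px py with isLeaf (proj₂ x) ∨ isLeaf (proj₂ y)
... | true  = merge px py ∷ []
... | false = keep px ∷ keep py ∷ []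

All-hpairs : ∀ {P Q : Cl × Tr Cl → Set} →
             (∀ {e} → P e → Q e) → (∀ {x y} → P x → P y → Q (hmergeE x y)) →
             ∀ {xs} → All P xs → All Q (hpairs xs)
All-hpairs keep merge []                 = []
All-hpairs keep merge (px ∷ [])          = keep px ∷ []
All-hpairs keep merge (px ∷ py ∷ [])     = All-pairStep keep merge px py
All-hpairs keep merge {x ∷ y ∷ z ∷ []} (px ∷ py ∷ pz ∷ [])
  with not (isLeaf (proj₂ x)) ∧ not (isLeaf (proj₂ y)) ∧ isLeaf (proj₂ z)
... | true  = keep px ∷ merge py pz ∷ []
... | false = All.++⁺ (All-pairStep keep merge px py) (keep pz ∷ [])
All-hpairs keep merge (px ∷ py ∷ pzs@(_ ∷ _ ∷ _)) =
  All.++⁺ (All-pairStep keep merge px py) (All-hpairs keep merge pzs)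

pairStep-≢[] : ∀ x y → pairStep x y ≢ []
pairStep-≢[] x y with isLeaf (proj₂ x) ∨ isLeaf (proj₂ y)
... | true  = λ ()
... | false = λ ()

hpairs-≢[] : ∀ x xs → hpairs (x ∷ xs) ≢ []
hpairs-≢[] x []           = λ ()
hpairs-≢[] x (y ∷ [])     = pairStep-≢[] x y
hpairs-≢[] x (y ∷ z ∷ []) with not (isLeaf (proj₂ x)) ∧ not (isLeaf (proj₂ y)) ∧ isLeaf (proj₂ z)
... | true  = λ ()
... | false = pairStep-≢[] x y ∘ List.++-conicalˡ (pairStep x y) (z ∷ [])
hpairs-≢[] x (y ∷ zs@(_ ∷ _ ∷ _)) = pairStep-≢[] x y ∘ List.++-conicalˡ (pairStep x y) (hpairs zs)

length-hpairs : ∀ xs → 2 ≤ length (hpairs xs) → 2 ≤ length xs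
length-hpairs []          ()
length-hpairs (_ ∷ [])    (s≤s ())
length-hpairs (_ ∷ _ ∷ _) _ = s≤s (s≤s z≤n)

startAll-++ : ∀ xs ys → startAll (xs ++ ys) ≡ startAll xs ++ startAll ys
startAll-++ []             ys = refl
startAll-++ ((c , s) ∷ xs) ys = cong (walk c [] s ∷_) (startAll-++ xs ys)

children : ∀ {L : Set} → Tr L → List (L × Tr L)
children (node es) = es

record Additive (w : Cl → ℤ) : Set where
  field
    hm-additive : ∀ f x y → w (hm f x y) ≡ w x ℤ.+ w y
    vm-additive : ∀ x y → w (vm x y) ≡ w x ℤ.+ w y

module _ {w : Cl → ℤ} (additive : Additive w) where
  open Additive additive

  ΣL-pairStep : ∀ x y → ΣL w (pairStep x y) ≡ ΣL w (x ∷ y ∷ [])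
  ΣL-pairStep (c₁ , node []) (c₂ , s₂) rewrite hm-additive true c₁ c₂ =
    regroup (w c₁) (w c₂) (ΣT w s₂)
    where
    regroup : ∀ a b t → ((a ℤ.+ b) ℤ.+ t) ℤ.+ 0ℤ ≡ (a ℤ.+ 0ℤ) ℤ.+ ((b ℤ.+ t) ℤ.+ 0ℤ)
    regroup = ℤ-Ring.solve-∀
  ΣL-pairStep (c₁ , s₁@(node (_ ∷ _))) (c₂ , node []) rewrite hm-additive false c₁ c₂ =
    regroup (w c₁) (w c₂) (ΣT w s₁)
    where
    regroup : ∀ a b t → ((a ℤ.+ b) ℤ.+ t) ℤ.+ 0ℤ ≡ (a ℤ.+ t) ℤ.+ ((b ℤ.+ 0ℤ) ℤ.+ 0ℤ)
    regroup = ℤ-Ring.solve-∀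
  ΣL-pairStep (_ , node (_ ∷ _)) (_ , node (_ ∷ _)) = refl

  ΣL-pairStep-++ : ∀ x y zs → ΣL w (pairStep x y ++ zs) ≡ ΣL w (x ∷ y ∷ zs)
  ΣL-pairStep-++ x y zs = begin
    ΣL w (pairStep x y ++ zs)          ≡⟨ ΣL-++ w (pairStep x y) zs ⟩
    ΣL w (pairStep x y) ℤ.+ ΣL w zs    ≡⟨ cong (ℤ._+ ΣL w zs) (ΣL-pairStep x y) ⟩
    ΣL w (x ∷ y ∷ []) ℤ.+ ΣL w zs      ≡⟨ ΣL-++ w (x ∷ y ∷ []) zs ⟨
    ΣL w (x ∷ y ∷ zs)                  ∎
    where open ≡-Reasoning

  ΣL-hpairs : ∀ xs → ΣL w (hpairs xs) ≡ ΣL w xs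
  ΣL-hpairs []           = refl
  ΣL-hpairs (x ∷ [])     = refl
  ΣL-hpairs (x ∷ y ∷ []) = ΣL-pairStep x y
  ΣL-hpairs (x@(_ , node []) ∷ y ∷ z ∷ []) =
    ΣL-pairStep-++ x y (z ∷ [])
  ΣL-hpairs (x@(_ , node (_ ∷ _)) ∷ y@(_ , node []) ∷ z ∷ []) =
    ΣL-pairStep-++ x y (z ∷ [])
  ΣL-hpairs (x@(_ , node (_ ∷ _)) ∷ y@(_ , node (_ ∷ _)) ∷ z@(_ , node (_ ∷ _)) ∷ []) =
    ΣL-pairStep-++ x y (z ∷ [])
  ΣL-hpairs (x@(_ , node (_ ∷ _)) ∷ y@(_ , node (_ ∷ _)) ∷ z@(_ , node []) ∷ []) =
    cong (ℤ._+_ (ΣE w x)) (ΣL-pairStep y z)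
  ΣL-hpairs (x ∷ y ∷ zs@(_ ∷ _ ∷ _)) =
    trans (ΣL-pairStep-++ x y (hpairs zs))
          (cong (λ r → ΣE w x ℤ.+ (ΣE w y ℤ.+ r)) (ΣL-hpairs zs))

  mutual
    ΣT-step1 : ∀ t → ΣT w (step1 t) ≡ ΣT w t
    ΣT-step1 (node es) = trans (ΣL-hpairs (step1L es)) (ΣL-step1L es)

    ΣL-step1L : ∀ es → ΣL w (step1L es) ≡ ΣL w es
    ΣL-step1L []             = refl
    ΣL-step1L ((c , s) ∷ es) = cong₂ (λ p q → (w c ℤ.+ p) ℤ.+ q) (ΣT-step1 s) (ΣL-step1L es)

  Σ⁺-vp : ∀ a cs → Σ⁺ w (vp a cs) ≡ w a ℤ.+ sumℤ (map w cs)
  Σ⁺-vp a []           = refl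
  Σ⁺-vp a (c ∷ []) with isHm c
  ... | true  = refl
  ... | false rewrite vm-additive c a = swap (w c) (w a)
    where
    swap : ∀ p q → (p ℤ.+ q) ℤ.+ 0ℤ ≡ q ℤ.+ (p ℤ.+ 0ℤ)
    swap = ℤ-Ring.solve-∀
  Σ⁺-vp a (c ∷ d ∷ cs) = begin
    Σ⁺ w (vm c a ∷⁺ vp d cs)          ≡⟨ Σ⁺-∷⁺ w (vm c a) (vp d cs) ⟩
    w (vm c a) ℤ.+ Σ⁺ w (vp d cs)     ≡⟨ cong₂ ℤ._+_ (vm-additive c a) (Σ⁺-vp d cs) ⟩
    (w c ℤ.+ w a) ℤ.+ (w d ℤ.+ rest)  ≡⟨ regroup (w a) (w c) (w d ℤ.+ rest) ⟩
    w a ℤ.+ (w c ℤ.+ (w d ℤ.+ rest))  ∎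
    where
    open ≡-Reasoning
    rest : ℤ
    rest = sumℤ (map w cs)
    regroup : ∀ p q r → (q ℤ.+ p) ℤ.+ r ≡ p ℤ.+ (q ℤ.+ r)
    regroup = ℤ-Ring.solve-∀

  mutual
    ΣE-walk : ∀ low above s → ΣE w (walk low above s) ≡ (w low ℤ.+ sumℤ (map w above)) ℤ.+ ΣT w s
    ΣE-walk low above (node [])                  = ΣE-walk-stop low above []
    ΣE-walk low above (node ((c , s) ∷ []))      =
      trans (ΣE-walk c (low ∷ above) s) (regroup (w low) (sumℤ (map w above)) (w c) (ΣT w s))
      where
      regroup : ∀ p q r t → (r ℤ.+ (p ℤ.+ q)) ℤ.+ t ≡ (p ℤ.+ q) ℤ.+ ((r ℤ.+ t) ℤ.+ 0ℤ)
      regroup = ℤ-Ring.solve-∀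
    ΣE-walk low above (node es@(_ ∷ _ ∷ _)) = ΣE-walk-stop low above es

    ΣE-walk-stop : ∀ low above es →
      ΣE w (buildPath (List⁺.reverse (vp low above)) (node (startAll es)))
        ≡ (w low ℤ.+ sumℤ (map w above)) ℤ.+ ΣL w es
    ΣE-walk-stop low above es =
      trans (ΣE-buildPath-reverse w (vp low above) (node (startAll es)))
            (cong₂ ℤ._+_ (Σ⁺-vp low above) (ΣL-startAll es))

    ΣL-startAll : ∀ es → ΣL w (startAll es) ≡ ΣL w es
    ΣL-startAll []             = refl
    ΣL-startAll ((c , s) ∷ es) =
      cong₂ ℤ._+_ (trans (ΣE-walk c [] s) (cong (ℤ._+ ΣT w s) (ℤ.+-identityʳ (w c))))
                  (ΣL-startAll es)

  ΣT-step2 : ∀ t → ΣT w (step2 t) ≡ ΣT w t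
  ΣT-step2 (node es) = ΣL-startAll es

-- Counting clusters

pieces : ℕ → Cl → ℕ
pieces b (base _)   = 1
pieces b (hm _ x y) = if okMerge b x y then 1 else pieces b x + pieces b y
pieces b (vm x y)   = if okMerge b x y then 1 else pieces b x + pieces b y

bases : Cl → ℕ
bases (base _)   = 1
bases (hm _ x y) = bases x + bases y
bases (vm x y)   = bases x + bases y

bigBases : ℕ → Cl → ℕ
bigBases b (base n)   = if n ≤ᵇ b then 0 else 1
bigBases b (hm _ x y) = bigBases b x + bigBases b y
bigBases b (vm x y)   = bigBases b x + bigBases b y

budget : ℕ → Cl → ℕ
budget b c = 7 * bases c + 8 * bigBases b c

1≤bases : ∀ c → 1 ≤ bases c
1≤bases (base _)   = s≤s z≤n
1≤bases (hm _ x y) = ℕ.≤-trans (1≤bases x) (ℕ.m≤m+n (bases x) (bases y))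
1≤bases (vm x y)   = ℕ.≤-trans (1≤bases x) (ℕ.m≤m+n (bases x) (bases y))

budget-vm : ∀ b x y → budget b (vm x y) ≡ budget b x + budget b y
budget-vm b x y = regroup (bases x) (bases y) (bigBases b x) (bigBases b y)
  where
  regroup : ∀ p q u v → 7 * (p + q) + 8 * (u + v) ≡ (7 * p + 8 * u) + (7 * q + 8 * v)
  regroup = ℕ-Ring.solve-∀

budget-additive : ∀ b → Additive (λ c → + budget b c)
budget-additive b = record
  { hm-additive = λ _ x y → additive x y
  ; vm-additive = additive
  }
  where
  additive : ∀ x y → + budget b (vm x y) ≡ + budget b x ℤ.+ + budget b y
  additive x y = trans (cong +_ (budget-vm b x y)) (ℤ.pos-+ (budget b x) (budget b y))

labelsL-++ : ∀ (xs ys : List (ℕ × Tr ℕ)) → labelsL (xs ++ ys) ≡ labelsL xs ++ labelsL ys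
labelsL-++ []             ys = refl
labelsL-++ ((l , s) ∷ xs) ys =
  cong (l ∷_) (trans (cong (labels s ++_) (labelsL-++ xs ys)) (sym (List.++-assoc (labels s) (labelsL xs) (labelsL ys))))

clusters-++ : ∀ xs ys → clusters (node (xs ++ ys)) ≡ clusters (node xs) + clusters (node ys)
clusters-++ xs ys = trans (cong length (labelsL-++ xs ys)) (List.length-++ (labelsL xs))

clusters-single : ∀ n s → clusters (node ((n , s) ∷ [])) ≡ suc (clusters s)
clusters-single n s = cong (suc ∘ length) (List.++-identityʳ (labels s))

clusters-realise : ∀ b c s → clusters (node (realise b c s)) ≡ pieces b c + clusters s
clusters-realise b (base n) s = clusters-single n s
clusters-realise b (hm f x y) s with okMerge b x y
... | true  = clusters-single (size x + size y) s
... | false with f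
...   | true  = begin
  clusters (node (realise b x leafTr ++ realise b y s))
    ≡⟨ clusters-++ (realise b x leafTr) (realise b y s) ⟩
  clusters (node (realise b x leafTr)) + clusters (node (realise b y s))
    ≡⟨ cong₂ _+_ (clusters-realise b x leafTr) (clusters-realise b y s) ⟩
  (pieces b x + 0) + (pieces b y + clusters s)
    ≡⟨ regroup (pieces b x) (pieces b y) (clusters s) ⟩
  (pieces b x + pieces b y) + clusters s ∎
  where
  open ≡-Reasoning
  regroup : ∀ p q r → (p + 0) + (q + r) ≡ (p + q) + r
  regroup = ℕ-Ring.solve-∀
...   | false = begin
  clusters (node (realise b x s ++ realise b y leafTr))
    ≡⟨ clusters-++ (realise b x s) (realise b y leafTr) ⟩
  clusters (node (realise b x s)) + clusters (node (realise b y leafTr))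
    ≡⟨ cong₂ _+_ (clusters-realise b x s) (clusters-realise b y leafTr) ⟩
  (pieces b x + clusters s) + (pieces b y + 0)
    ≡⟨ regroup (pieces b x) (pieces b y) (clusters s) ⟩
  (pieces b x + pieces b y) + clusters s ∎
  where
  open ≡-Reasoning
  regroup : ∀ p q r → (p + r) + (q + 0) ≡ (p + q) + r
  regroup = ℕ-Ring.solve-∀
clusters-realise b (vm x y) s with okMerge b x y
... | true  = clusters-single (size x + size y) s
... | false = begin
  clusters (node (realise b x (node (realise b y s))))
    ≡⟨ clusters-realise b x (node (realise b y s)) ⟩
  pieces b x + clusters (node (realise b y s))
    ≡⟨ cong (_+_ (pieces b x)) (clusters-realise b y s) ⟩
  pieces b x + (pieces b y + clusters s)
    ≡⟨ ℕ.+-assoc (pieces b x) (pieces b y) (clusters s) ⟨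
  (pieces b x + pieces b y) + clusters s ∎
  where open ≡-Reasoning

mutual
  ΣT-pieces : ∀ b k t → ΣT (λ c → + (k * pieces b c)) t ≡ + (k * clusters (realiseTr b t))
  ΣT-pieces b k (node es) = ΣL-pieces b k es

  ΣL-pieces : ∀ b k es → ΣL (λ c → + (k * pieces b c)) es ≡ + (k * clusters (node (realiseL b es)))
  ΣL-pieces b k []             = cong +_ (sym (ℕ.*-zeroʳ k))
  ΣL-pieces b k ((c , s) ∷ es) = begin
    (+ (k * pieces b c) ℤ.+ ΣT (λ c → + (k * pieces b c)) s) ℤ.+ ΣL (λ c → + (k * pieces b c)) es
      ≡⟨ cong₂ (λ p q → (+ (k * pieces b c) ℤ.+ p) ℤ.+ q) (ΣT-pieces b k s) (ΣL-pieces b k es) ⟩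
    (+ (k * pieces b c) ℤ.+ + (k * m)) ℤ.+ + (k * n)
      ≡⟨ cong (ℤ._+ + (k * n)) (ℤ.pos-+ (k * pieces b c) (k * m)) ⟨
    + (k * pieces b c + k * m) ℤ.+ + (k * n)
      ≡⟨ ℤ.pos-+ (k * pieces b c + k * m) (k * n) ⟨
    + (k * pieces b c + k * m + k * n)
      ≡⟨ cong +_ (distrib k (pieces b c) m n) ⟩
    + (k * ((pieces b c + m) + n))
      ≡⟨ cong (λ p → + (k * (p + n))) (clusters-realise b c (realiseTr b s)) ⟨
    + (k * (clusters (node (realise b c (realiseTr b s))) + n))
      ≡⟨ cong (λ p → + (k * p)) (clusters-++ (realise b c (realiseTr b s)) (realiseL b es)) ⟨
    + (k * clusters (node (realise b c (realiseTr b s) ++ realiseL b es))) ∎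
    where
    open ≡-Reasoning
    m n : ℕ
    m = clusters (realiseTr b s)
    n = clusters (node (realiseL b es))
    distrib : ∀ k p q r → k * p + k * q + k * r ≡ k * ((p + q) + r)
    distrib = ℕ-Ring.solve-∀

ΣT-toCl : ∀ w cs → ΣT w (toCl (node cs)) ≡ sumℤ (map (w ∘ base) (labelsL cs))
ΣT-toCl w []                     = refl
ΣT-toCl w ((n , node cs′) ∷ cs) = begin
  (w (base n) ℤ.+ ΣT w (toCl (node cs′))) ℤ.+ ΣT w (toCl (node cs))
    ≡⟨ cong₂ (λ p q → (w (base n) ℤ.+ p) ℤ.+ q) (ΣT-toCl w cs′) (ΣT-toCl w cs) ⟩
  (w (base n) ℤ.+ sum cs′) ℤ.+ sum cs
    ≡⟨ ℤ.+-assoc (w (base n)) (sum cs′) (sum cs) ⟩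
  w (base n) ℤ.+ (sum cs′ ℤ.+ sum cs)
    ≡⟨ cong (ℤ._+_ (w (base n))) (sumℤ-++ (map (w ∘ base) (labelsL cs′)) (map (w ∘ base) (labelsL cs))) ⟨
  w (base n) ℤ.+ sumℤ (map (w ∘ base) (labelsL cs′) ++ map (w ∘ base) (labelsL cs))
    ≡⟨ cong (λ l → w (base n) ℤ.+ sumℤ l) (List.map-++ (w ∘ base) (labelsL cs′) (labelsL cs)) ⟨
  w (base n) ℤ.+ sumℤ (map (w ∘ base) (labelsL cs′ ++ labelsL cs)) ∎
  where
  open ≡-Reasoning
  sum : List (ℕ × Tr ℕ) → ℤ
  sum es = sumℤ (map (w ∘ base) (labelsL es))

≤ᵇ≡not<ᵇ : ∀ m n → (m ≤ᵇ n) ≡ not (n <ᵇ m)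
≤ᵇ≡not<ᵇ 0             n       = refl
≤ᵇ≡not<ᵇ (suc m)       0       = refl
≤ᵇ≡not<ᵇ 1             (suc n) = refl
≤ᵇ≡not<ᵇ (suc (suc m)) (suc n) = ≤ᵇ≡not<ᵇ (suc m) n

sumℤ-budget : ∀ b l → sumℤ (map (λ n → + budget b (base n)) l)
                      ≡ + (7 * length l + 8 * length (filter (b <?_) l))
sumℤ-budget b []      = refl
sumℤ-budget b (n ∷ l) rewrite ≤ᵇ≡not<ᵇ n b with b <ᵇ n
... | true  = trans (cong (ℤ._+_ (+ 15)) (sumℤ-budget b l)) (cong +_ (count (length l) (length (filter (b <?_) l))))
  where
  count : ∀ p q → 15 + (7 * p + 8 * q) ≡ 7 * suc p + 8 * suc q
  count = ℕ-Ring.solve-∀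
... | false = trans (cong (ℤ._+_ (+ 7)) (sumℤ-budget b l)) (cong +_ (count (length l) (length (filter (b <?_) l))))
  where
  count : ∀ p q → 7 + (7 * p + 8 * q) ≡ 7 * suc p + 8 * q
  count = ℕ-Ring.solve-∀

ΣT-budget : ∀ b T → ΣT (λ c → + budget b c) (toCl T) ≡ + (7 * clusters T + 8 * bigClusters b T)
ΣT-budget b (node cs) = trans (ΣT-toCl (λ c → + budget b c) cs) (sumℤ-budget b (labelsL cs))

-- The potential

data Step1Edge : Cl → Set where
  base : ∀ {n} → Step1Edge (base n)
  hm   : ∀ {f n m} → Step1Edge (hm f (base n) (base m))

module _ (b : ℕ) where

  φ : Cl → ℤ
  φ c = + (8 * pieces b c) ℤ.- + budget b c

  φ-base-≤1 : ∀ n → φ (base n) ℤ.≤ + 1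
  φ-base-≤1 n with n ≤ᵇ b
  ... | true  = ≤-lit
  ... | false = ≤-lit

  φ-base-oversized : ∀ {n} → (n ≤ᵇ b) ≡ false → φ (base n) ℤ.≤ -6
  φ-base-oversized oversized rewrite oversized = ≤-lit

  φ-hm : ∀ {f n m} → φ (hm f (base n) (base m)) ℤ.≤ -6
  φ-hm {n = n} {m} with n ≤ᵇ b | m ≤ᵇ b
  ... | true  | true  = ≤-lit
  ... | true  | false = ≤-lit
  ... | false | true  = ≤-lit
  ... | false | false = ≤-lit

  φ-≤1 : ∀ {c} → Step1Edge c → φ c ℤ.≤ + 1
  φ-≤1 (base {n})       = φ-base-≤1 n
  φ-≤1 (hm {f} {n} {m}) = loosen (φ-hm {f} {n} {m})

  φ-oversized : ∀ {c} → Step1Edge c → (size c ≤ᵇ b) ≡ false → φ c ℤ.≤ -6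
  φ-oversized (base {n}) oversized = φ-base-oversized {n} oversized
  φ-oversized (hm {f} {n} {m}) _   = φ-hm {f} {n} {m}

  φ-vm-merged : ∀ {x y} → okMerge b x y ≡ true → φ (vm x y) ℤ.≤ -6
  φ-vm-merged {x} {y} merged rewrite merged =
    m+k≤n⇒+m-+n≤-k 6 (ℕ.≤-trans (ℕ.*-monoʳ-≤ 7 (ℕ.+-mono-≤ (1≤bases x) (1≤bases y)))
                               (ℕ.m≤m+n (7 * (bases x + bases y)) (8 * (bigBases b x + bigBases b y))))

  φ-vm-unmerged : ∀ {x y} → okMerge b x y ≡ false → φ (vm x y) ≡ φ x ℤ.+ φ y
  φ-vm-unmerged {x} {y} unmerged rewrite unmerged = begin
    + (8 * (pieces b x + pieces b y)) ℤ.- + budget b (vm x y)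
      ≡⟨ cong₂ (λ p q → + p ℤ.- + q) (ℕ.*-distribˡ-+ 8 (pieces b x) (pieces b y)) (budget-vm b x y) ⟩
    + (8 * pieces b x + 8 * pieces b y) ℤ.- + (budget b x + budget b y)
      ≡⟨ cong₂ ℤ._-_ (ℤ.pos-+ (8 * pieces b x) (8 * pieces b y)) (ℤ.pos-+ (budget b x) (budget b y)) ⟩
    (+ (8 * pieces b x) ℤ.+ + (8 * pieces b y)) ℤ.- (+ budget b x ℤ.+ + budget b y)
      ≡⟨ [a-b]+[c-d]≡[a+c]-[b+d] (+ (8 * pieces b x)) (+ budget b x) (+ (8 * pieces b y)) (+ budget b y) ⟨
    φ x ℤ.+ φ y ∎
    where open ≡-Reasoning

  φ-vm : ∀ {x y} → Step1Edge x → Step1Edge y → φ (vm x y) ℤ.≤ -5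
  φ-vm {x} {y} ex ey = by-fit (size x ≤ᵇ b) (size y ≤ᵇ b) refl refl
    where
    by-fit : ∀ p q → (size x ≤ᵇ b) ≡ p → (size y ≤ᵇ b) ≡ q → φ (vm x y) ℤ.≤ -5
    by-fit true  true  x-fits y-fits = loosen (φ-vm-merged {x} {y} (cong₂ _∧_ x-fits y-fits))
    by-fit false _     x-big  _      =
      ≡-≤-trans (φ-vm-unmerged {x} {y} (cong (_∧ (size y ≤ᵇ b)) x-big)) (φ-oversized ex x-big ⊕ φ-≤1 ey)
    by-fit true  false x-fits y-big  =
      ≡-≤-trans (φ-vm-unmerged {x} {y} (cong₂ _∧_ x-fits y-big)) (φ-≤1 ex ⊕ φ-oversized ey y-big)

  ΦE : Cl × Tr Cl → ℤ
  ΦE (c , s) = ΣE φ (walk c [] s)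

  ΦL : List (Cl × Tr Cl) → ℤ
  ΦL es = ΣL φ (startAll es)

  ΦL-++ : ∀ xs ys → ΦL (xs ++ ys) ≡ ΦL xs ℤ.+ ΦL ys
  ΦL-++ xs ys = trans (cong (ΣL φ) (startAll-++ xs ys)) (ΣL-++ φ (startAll xs) (startAll ys))

  data Step1Tree : Tr Cl → Set where
    leaf   : Step1Tree (node [])
    unary  : ∀ {c s} → Step1Edge c → Step1Tree s → Step1Tree (node ((c , s) ∷ []))
    branch : ∀ {e f es} → ΦL (e ∷ f ∷ es) ℤ.≤ -2 → Step1Tree (node (e ∷ f ∷ es))

  mutual
    Σ⁺-vp-≤1 : ∀ {a cs} → Step1Edge a → All Step1Edge cs → Σ⁺ φ (vp a cs) ℤ.≤ + 1
    Σ⁺-vp-≤1 ea []         = loosen (φ-≤1 ea ⊕ ℤ.≤-refl)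
    Σ⁺-vp-≤1 ea (ec ∷ ecs) = loosen (Σ⁺-vp-≤-4 ea (ec ∷ ecs))

    Σ⁺-vp-≤-4 : ∀ {a c cs} → Step1Edge a → All Step1Edge (c ∷ cs) → Σ⁺ φ (vp a (c ∷ cs)) ℤ.≤ -4
    Σ⁺-vp-≤-4 ea (base {n} ∷ [])         = loosen (φ-vm (base {n}) ea ⊕ ℤ.≤-refl)
    Σ⁺-vp-≤-4 ea (hm {f} {n} {m} ∷ [])   = loosen (φ-≤1 ea ⊕ φ-hm {f} {n} {m} ⊕ ℤ.≤-refl)
    Σ⁺-vp-≤-4 {a} ea (_∷_ {c} ec (_∷_ {d} {cs} ed ecs)) = begin
      Σ⁺ φ (vm c a ∷⁺ vp d cs)        ≡⟨ Σ⁺-∷⁺ φ (vm c a) (vp d cs) ⟩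
      φ (vm c a) ℤ.+ Σ⁺ φ (vp d cs)   ≤⟨ φ-vm ec ea ⊕ Σ⁺-vp-≤1 ed ecs ⟩
      -4                              ∎
      where open ℤ.≤-Reasoning

  ΣE-walk-≤-4 : ∀ {s low c above} → Step1Tree s → Step1Edge low → All Step1Edge (c ∷ above) →
                ΣE φ (walk low (c ∷ above) s) ℤ.≤ -4
  ΣE-walk-≤-4 {low = low} {c} {above} leaf el ecs =
    ≡-≤-trans (ΣE-buildPath-reverse φ (vp low (c ∷ above)) (node []))
              (loosen (Σ⁺-vp-≤-4 el ecs ⊕ ℤ.≤-refl))
  ΣE-walk-≤-4 (unary ec t) el ecs = ΣE-walk-≤-4 t ec (el ∷ ecs)
  ΣE-walk-≤-4 {node es} {low} {c} {above} (branch bound) el ecs =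
    ≡-≤-trans (ΣE-buildPath-reverse φ (vp low (c ∷ above)) (node (startAll es)))
              (loosen (Σ⁺-vp-≤-4 el ecs ⊕ bound))

  ΦE-leaf : ∀ c → ΦE (c , node []) ≡ φ c
  ΦE-leaf c = trans (ΣE-buildPath-reverse φ (c ∷ []) (node []))
                    (trans (ℤ.+-identityʳ (φ c ℤ.+ 0ℤ)) (ℤ.+-identityʳ (φ c)))

  ΦE-branch : ∀ c e f es → ΦE (c , node (e ∷ f ∷ es)) ≡ φ c ℤ.+ ΦL (e ∷ f ∷ es)
  ΦE-branch c e f es = trans (ΣE-buildPath-reverse φ (c ∷ []) (node (startAll (e ∷ f ∷ es))))
                             (cong (ℤ._+ ΦL (e ∷ f ∷ es)) (ℤ.+-identityʳ (φ c)))

  ΦE-≤1 : ∀ {c s} → Step1Edge c → Step1Tree s → ΦE (c , s) ℤ.≤ + 1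
  ΦE-≤1 {c} ec leaf                        = ≡-≤-trans (ΦE-leaf c) (φ-≤1 ec)
  ΦE-≤1 ec (unary ec′ t)                   = loosen (ΣE-walk-≤-4 t ec′ (ec ∷ []))
  ΦE-≤1 {c} ec (branch {e} {f} {es} bound) = ≡-≤-trans (ΦE-branch c e f es) (loosen (φ-≤1 ec ⊕ bound))

  ΦE-nonleaf : ∀ {c es} → Step1Edge c → Step1Tree (node es) → es ≢ [] → ΦE (c , node es) ℤ.≤ -1
  ΦE-nonleaf ec leaf nonempty                   = contradiction refl nonempty
  ΦE-nonleaf ec (unary ec′ t) _                 = loosen (ΣE-walk-≤-4 t ec′ (ec ∷ []))
  ΦE-nonleaf {c} ec (branch {e} {f} {es} bound) _ = ≡-≤-trans (ΦE-branch c e f es) (φ-≤1 ec ⊕ bound)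

  ΦE-hm : ∀ {f n m s} → Step1Tree s → ΦE (hm f (base n) (base m) , s) ℤ.≤ -4
  ΦE-hm {f} {n} {m} leaf = ≡-≤-trans (ΦE-leaf (hm f (base n) (base m))) (loosen (φ-hm {f} {n} {m}))
  ΦE-hm (unary ec t)     = ΣE-walk-≤-4 t ec (hm ∷ [])
  ΦE-hm {f} {n} {m} (branch {e} {f′} {es} bound) =
    ≡-≤-trans (ΦE-branch (hm f (base n) (base m)) e f′ es) (loosen (φ-hm {f} {n} {m} ⊕ bound))

  data BaseChild : Cl × Tr Cl → Set where
    base : ∀ {n s} → Step1Tree s → BaseChild (base n , s)

  Step1Child : Cl × Tr Cl → Set
  Step1Child (c , s) = Step1Edge c × Step1Tree s

  ΦL-pairStep : ∀ {x y} → BaseChild x → BaseChild y → ΦL (pairStep x y) ℤ.≤ -2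
  ΦL-pairStep (base {s = node []} _) (base u) = loosen (ΦE-hm u ⊕ ℤ.≤-refl)
  ΦL-pairStep (base {s = node (_ ∷ _)} t) (base {s = node []} _) = loosen (ΦE-hm t ⊕ ℤ.≤-refl)
  ΦL-pairStep (base {s = node (_ ∷ _)} t) (base {s = node (_ ∷ _)} u) =
    ΦE-nonleaf base t (λ ()) ⊕ ΦE-nonleaf base u (λ ()) ⊕ ℤ.≤-refl

  ΦL-hpairs : ∀ {xs} → All BaseChild xs → 2 ≤ length xs → ΦL (hpairs xs) ℤ.≤ -2
  ΦL-hpairs []           ()
  ΦL-hpairs (_ ∷ [])     (s≤s ())
  ΦL-hpairs (x ∷ y ∷ []) _ = ΦL-pairStep x y
  ΦL-hpairs (base {s = node []} _ ∷ base u ∷ base v ∷ []) _ =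
    loosen (ΦE-hm u ⊕ ΦE-≤1 base v ⊕ ℤ.≤-refl)
  ΦL-hpairs (base {s = node (_ ∷ _)} t ∷ base {s = node []} _ ∷ base v ∷ []) _ =
    loosen (ΦE-hm t ⊕ ΦE-≤1 base v ⊕ ℤ.≤-refl)
  ΦL-hpairs (base {s = node (_ ∷ _)} t ∷ base {s = node (_ ∷ _)} u ∷ base {s = node (_ ∷ _)} v ∷ []) _ =
    loosen (ΦE-nonleaf base t (λ ()) ⊕ ΦE-nonleaf base u (λ ()) ⊕ ΦE-nonleaf base v (λ ()) ⊕ ℤ.≤-refl)
  ΦL-hpairs (base {s = node (_ ∷ _)} t ∷ base {s = node (_ ∷ _)} u ∷ base {s = node []} _ ∷ []) _ =
    loosen (ΦE-nonleaf base t (λ ()) ⊕ ΦE-hm u ⊕ ℤ.≤-refl)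
  ΦL-hpairs {x ∷ y ∷ zs@(_ ∷ _ ∷ _)} (bx ∷ by ∷ bzs@(_ ∷ _ ∷ _)) _ =
    ≡-≤-trans (ΦL-++ (pairStep x y) (hpairs zs))
              (loosen (ΦL-pairStep bx by ⊕ ΦL-hpairs bzs (s≤s (s≤s z≤n))))

  Step1Tree-node : ∀ {es} → All Step1Child es → (2 ≤ length es → ΦL es ℤ.≤ -2) → Step1Tree (node es)
  Step1Tree-node []               _     = leaf
  Step1Tree-node ((ec , t) ∷ [])  _     = unary ec t
  Step1Tree-node (_ ∷ _ ∷ _)      bound = branch (bound (s≤s (s≤s z≤n)))

  hmergeE-Step1Child : ∀ {x y} → BaseChild x → BaseChild y → Step1Child (hmergeE x y)
  hmergeE-Step1Child {_ , s} (base t) (base u) with isLeaf s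
  ... | true  = hm , u
  ... | false = hm , t

  BaseChild⇒Step1Child : ∀ {e} → BaseChild e → Step1Child e
  BaseChild⇒Step1Child (base t) = base , t

  mutual
    Step1Tree-step1 : ∀ T → Step1Tree (step1 (toCl T))
    Step1Tree-step1 (node cs) =
      Step1Tree-node (All-hpairs BaseChild⇒Step1Child hmergeE-Step1Child (BaseChild-step1 cs))
                     (ΦL-hpairs (BaseChild-step1 cs) ∘ length-hpairs (step1L (children (toCl (node cs)))))

    BaseChild-step1 : ∀ cs → All BaseChild (step1L (children (toCl (node cs))))
    BaseChild-step1 []             = []
    BaseChild-step1 ((_ , t) ∷ cs) = base (Step1Tree-step1 t) ∷ BaseChild-step1 cs

  ΣT-φ-≤0 : ∀ T → 2 ≤ clusters T → ΣT φ (step2 (step1 (toCl T))) ℤ.≤ 0ℤ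
  ΣT-φ-≤0 (node [])                                  _ = ℤ.≤-refl
  ΣT-φ-≤0 (node ((_ , node []) ∷ []))                (s≤s ())
  ΣT-φ-≤0 (node ((_ , t@(node ((m , t′) ∷ cs))) ∷ [])) _ =
    loosen (ΦE-nonleaf base (Step1Tree-step1 t) nonempty ⊕ ℤ.≤-refl)
    where
    nonempty : hpairs (step1L (children (toCl t))) ≢ []
    nonempty = hpairs-≢[] (base m , step1 (toCl t′)) (step1L (children (toCl (node cs))))
  ΣT-φ-≤0 (node cs@(_ ∷ _ ∷ _))                      _ =
    loosen (ΦL-hpairs (BaseChild-step1 cs) (s≤s (s≤s z≤n)))

iteration-bound : ∀ b T → 2 ≤ clusters T →
                  8 * clusters (iteration b T) ≤ 7 * clusters T + 8 * bigClusters b T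
iteration-bound b T two-clusters =
  ℤ.drop‿+≤+ (ℤ.i-j≤0⇒i≤j (≡-≤-trans (sym potential-sum) (ΣT-φ-≤0 b T two-clusters)))
  where
  open ≡-Reasoning
  potential-sum : ΣT (φ b) (step2 (step1 (toCl T)))
                ≡ + (8 * clusters (iteration b T)) ℤ.- + (7 * clusters T + 8 * bigClusters b T)
  potential-sum = begin
    ΣT (φ b) (step2 (step1 (toCl T)))
      ≡⟨ ΣT-sub (λ c → + (8 * pieces b c)) (λ c → + budget b c) (step2 (step1 (toCl T))) ⟩
    ΣT (λ c → + (8 * pieces b c)) (step2 (step1 (toCl T))) ℤ.- ΣT (λ c → + budget b c) (step2 (step1 (toCl T)))
      ≡⟨ cong₂ ℤ._-_ (ΣT-pieces b 8 (step2 (step1 (toCl T))))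
                     (trans (ΣT-step2 (budget-additive b) (step1 (toCl T)))
                            (trans (ΣT-step1 (budget-additive b) (toCl T)) (ΣT-budget b T))) ⟩
    + (8 * clusters (iteration b T)) ℤ.- + (7 * clusters T + 8 * bigClusters b T) ∎

lemma2 : {Lbl : Set} (θ : ℕ → ℕ) → (∀ t → 1 ≤ θ t) → (∀ t → θ t ≤ θ (suc t))
    → (T : LTree Lbl) (k : ℕ)
    → 2 ≤ clusters (run θ T k)
    → 8 * clusters (run θ T (suc k))
      ≤ 7 * clusters (run θ T k) + 8 * bigClusters (θ (suc k)) (run θ T k)
lemma2 θ _ _ T k = iteration-bound (θ (suc k)) (run θ T k)
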